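{- Let $\mathcal Q.\phi$ be a QBF. If there exists a QNS refutation, or a Q-SA refutation, or a Q-SoS refutation of $\mathcal Q.\phi$, then $\mathcal Q.\phi$ is false.
   Context: A QBF $\mathcal Q.\phi$ consists of a quantifier prefix $\mathcal Q$ that quantifies each variable of a finite set $V$ of Boolean variables exactly once, existentially or universally, in a linear order, together with a CNF formula $\phi$ over $V$. It is false if the universal player has a winning strategy in the evaluation game: variables receive values in $\{0,1\}$ in the order of $\mathcal Q$, existential ones chosen by the existential player and universal ones by the universal player, and the existential player wins iff $\phi$ is satisfied. For each $v\in V$ let $\overline v$ be a new formal variable (its twin); polynomials live in $\mathbb Q[V\cup\overline V]$, and a Boolean assignment $\alpha$ to $V$ is extended by $\overline v\mapsto 1-\alpha(v)$. A clause $C=\bigvee_{v\in P}v\vee\bigvee_{v\in N}\neg v$ is encoded as $\mathrm{enc}(C)=\{\prod_{v\in P}\overline v\prod_{v\in N}v\}\cup\{v^2-v,\ v+\overline v-1: v\in P\cup N\}$, and $\mathrm{enc}(\phi)$ is the union of $\mathrm{enc}(C)$ over the clauses $C$ of $\phi$. A Q-Sum-of-Squares (Q-SoS) refutation of $\mathcal Q.\phi$ is a polynomial identity $\sum_{p\in \mathrm{enc}(\phi)}q_pp+\sum_{u}q_u(1-2u)+q+1=0$ in $\mathbb Q[V\cup\overline V]$, where $u$ ranges over the universally quantified variables, every variable $v$ or $\overline v$ occurring in $q_u$ has $v$ quantified to the left of $u$ in $\mathcal Q$, and $q$ is a sum of squares of polynomials. A Q-Sherali-Adams (Q-SA) refutation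 is the same but with $q$ a polynomial with nonnegative coefficients, and a Q-Nullstellensatz (QNS) refutation is the same with $q=0$. -}

module Defs where

open import Data.Bool using (Bool; true; false; not; _∧_; _∨_; if_then_else_; T)
open import Data.Nat as ℕ using (ℕ; zero; suc)
open import Data.Fin as Fin using (Fin; _<_; _≤_)
open import Data.Fin.Subset using (Subset)
open import Data.Vec as Vec using (Vec; lookup; replicate; zipWith; tabulate)
import Data.Vec.Properties as VecP
open import Data.List as List using (List; []; _∷_; _++_; foldr; allFin; concatMap)
open import Data.List.Relation.Unary.All using (All)
open import Data.List.Relation.Unary.Any using (Any)
open import Data.Product using (Σ; ∃; ∃-syntax; _×_; _,_; proj₁; proj₂)
open import Data.Rational as ℚ using (ℚ; 0ℚ; 1ℚ)
open import Relation.Nullary using (¬_; yes; no)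
open import Relation.Binary.PropositionalEquality using (_≡_; _≢_)

-- The variable set V is Fin n; the quantifier prefix Q quantifies the
-- variables in the linear order 0 < 1 < ... < n-1, and assigns to each
-- variable its quantifier.

data Quant : Set where
  exist univ : Quant

Prefix : ℕ → Set
Prefix n = Fin n → Quant

-- A clause  ⋁_{v∈P} v ∨ ⋁_{v∈N} ¬v  given by the two sets P and N.
record Clause (n : ℕ) : Set where
  constructor clause
  field
    P : Subset n
    N : Subset n
open Clause public

CNF : ℕ → Set
CNF n = List (Clause n)

Assignment : ℕ → Set
Assignment n = Fin n → Bool

SatClause : ∀ {n} → Assignment n → Clause n → Set
SatClause α C = ∃[ v ] T ((lookup (P C) v ∧ α v) ∨ (lookup (N C) v ∧ not (α v)))

Sat : ∀ {n} → Assignment n → CNF n → Set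
Sat α φ = All (SatClause α) φ

-- A strategy for the universal player: for every variable u a choice
-- function which may only depend on the values of variables quantified
-- before u.  (Only its values at universal u matter.)
record UStrategy (n : ℕ) : Set where
  field
    choose : Fin n → Assignment n → Bool
    onlyPast : ∀ u (α β : Assignment n) →
               (∀ v → v < u → α v ≡ β v) → choose u α ≡ choose u β
open UStrategy public

-- Since the existential player
-- may choose anything at each existential variable (depending on the
-- past), the plays against σ are exactly the consistent assignments.
Consistent : ∀ {n} → Prefix n → UStrategy n → Assignment n → Set
Consistent Q σ α = ∀ u → Q u ≡ univ → α u ≡ choose σ u α

UWins : ∀ {n} → Prefix n → CNF n → UStrategy n → Set
UWins Q φ σ = ∀ α → Consistent Q σ α → ¬ Sat α φ

QBFFalse : ∀ {n} → Prefix n → CNF n → Set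
QBFFalse Q φ = ∃[ σ ] UWins Q φ σ

-- Polynomials in ℚ[V ∪ V̄].
-- A monomial records an exponent for each v (vexp) and each twin v̄ (bexp).

record Mono (n : ℕ) : Set where
  constructor mono
  field
    vexp : Vec ℕ n
    bexp : Vec ℕ n
open Mono public

mono≟ : ∀ {n} (m m' : Mono n) → Bool
mono≟ (mono a b) (mono c d) with VecP.≡-dec ℕ._≟_ a c | VecP.≡-dec ℕ._≟_ b d
... | yes _ | yes _ = true
... | _     | _     = false

unitMono : ∀ {n} → Mono n
unitMono = mono (replicate _ 0) (replicate _ 0)

_·m_ : ∀ {n} → Mono n → Mono n → Mono n
mono a b ·m mono c d = mono (zipWith ℕ._+_ a c) (zipWith ℕ._+_ b d)

-- A polynomial is a formal finite sum of terms (coefficient, monomial);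
-- two such sums denote the same polynomial iff all coefficients agree.
Poly : ℕ → Set
Poly n = List (ℚ × Mono n)

coeff : ∀ {n} → Poly n → Mono n → ℚ
coeff [] m = 0ℚ
coeff ((c , m') ∷ p) m = if mono≟ m' m then c ℚ.+ coeff p m else coeff p m

_≈P_ : ∀ {n} → Poly n → Poly n → Set
p ≈P q = ∀ m → coeff p m ≡ coeff q m

infix 4 _≈P_
infixl 6 _+P_ _-P_
infixl 7 _*P_

0P : ∀ {n} → Poly n
0P = []

constP : ∀ {n} → ℚ → Poly n
constP c = (c , unitMono) ∷ []

1P : ∀ {n} → Poly n
1P = constP 1ℚ

varP : ∀ {n} → Fin n → Poly n
varP {n} v = (1ℚ , mono (tabulate (λ w → if Fin.toℕ w ℕ.≡ᵇ Fin.toℕ v then 1 else 0)) (replicate n 0)) ∷ []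

barP : ∀ {n} → Fin n → Poly n
barP {n} v = (1ℚ , mono (replicate n 0) (tabulate (λ w → if Fin.toℕ w ℕ.≡ᵇ Fin.toℕ v then 1 else 0))) ∷ []

_+P_ : ∀ {n} → Poly n → Poly n → Poly n
p +P q = p ++ q

negP : ∀ {n} → Poly n → Poly n
negP = List.map (λ { (c , m) → (ℚ.- c , m) })

_-P_ : ∀ {n} → Poly n → Poly n → Poly n
p -P q = p +P negP q

_*P_ : ∀ {n} → Poly n → Poly n → Poly n
p *P q = concatMap (λ { (c , m) → List.map (λ { (d , m') → (c ℚ.* d , m ·m m') }) q }) p

sumP : ∀ {n} → List (Poly n) → Poly n
sumP = foldr _+P_ 0P

prodP : ∀ {n} → List (Poly n) → Poly n
prodP = foldr _*P_ 1P

ΣV : ∀ {n} → (Fin n → Poly n) → Poly n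
ΣV {n} f = sumP (List.map f (allFin n))

ΣV[_] : ∀ {n} → (Fin n → Bool) → (Fin n → Poly n) → Poly n
ΣV[ b ] f = ΣV (λ v → if b v then f v else 0P)

clauseMonoP : ∀ {n} → Clause n → Poly n
clauseMonoP {n} C = prodP (List.map (λ v →
    (if lookup (P C) v then barP v else 1P) *P (if lookup (N C) v then varP v else 1P))
  (allFin n))

inVars : ∀ {n} → Clause n → Fin n → Bool
inVars C v = lookup (P C) v ∨ lookup (N C) v

booleanAx : ∀ {n} → Fin n → Poly n
booleanAx v = (varP v *P varP v) -P varP v

twinAx : ∀ {n} → Fin n → Poly n
twinAx v = (varP v +P barP v) -P 1P

-- Coefficients attached to the elements of enc(C):
-- a coefficient for the main polynomial, and for every v ∈ P ∪ N one for
-- v² - v and one for v + v̄ - 1.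
record ClauseCoeffs (n : ℕ) : Set where
  field
    qMain : Poly n
    qBool : Fin n → Poly n
    qTwin : Fin n → Poly n
open ClauseCoeffs public

encSum : ∀ {n} → Clause n → ClauseCoeffs n → Poly n
encSum C k = (qMain k *P clauseMonoP C)
  +P ΣV[ inVars C ] (λ v → (qBool k v *P booleanAx v) +P (qTwin k v *P twinAx v))

encSumCNF : ∀ {n} → (φ : CNF n) → (Fin (List.length φ) → ClauseCoeffs n) → Poly n
encSumCNF [] ks = 0P
encSumCNF (C ∷ φ) ks = encSum C (ks Fin.zero) +P encSumCNF φ (λ i → ks (Fin.suc i))

isForall : Quant → Bool
isForall exist = false
isForall univ = true

OnlyLeftOf : ∀ {n} → Fin n → Poly n → Set
OnlyLeftOf u p = ∀ m → coeff p m ≢ 0ℚ → ∀ v → u ≤ v →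
                 lookup (vexp m) v ≡ 0 × lookup (bexp m) v ≡ 0

record Refutation {n} (Q : Prefix n) (φ : CNF n) (Good : Poly n → Set) : Set where
  field
    qEnc   : Fin (List.length φ) → ClauseCoeffs n
    qU     : Fin n → Poly n
    qU-ok  : ∀ u → Q u ≡ univ → OnlyLeftOf u (qU u)
    q      : Poly n
    q-good : Good q
    identity : encSumCNF φ qEnc
               +P ΣV[ (λ u → isForall (Q u)) ] (λ u → qU u *P (1P -P (constP (1ℚ ℚ.+ 1ℚ) *P varP u)))
               +P q +P 1P
               ≈P 0P

IsZeroP : ∀ {n} → Poly n → Set
IsZeroP q = q ≈P 0P

NonnegCoeffs : ∀ {n} → Poly n → Set
NonnegCoeffs q = ∀ m → 0ℚ ℚ.≤ coeff q m

IsSoS : ∀ {n} → Poly n → Set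
IsSoS q = ∃[ ss ] q ≈P sumP (List.map (λ s → s *P s) ss)

QNSRefutation : ∀ {n} → Prefix n → CNF n → Set
QNSRefutation Q φ = Refutation Q φ IsZeroP

QSARefutation : ∀ {n} → Prefix n → CNF n → Set
QSARefutation Q φ = Refutation Q φ NonnegCoeffs

QSoSRefutation : ∀ {n} → Prefix n → CNF n → Set
QSoSRefutation Q φ = Refutation Q φ IsSoS

-- Evaluate the refutation identity at a Boolean point α (with v̄ ↦ 1 - α v).
-- If α satisfies φ, every product q_p p with p ∈ enc(φ) vanishes and q is
-- nonnegative, so the identity reads 0 = (Σ_u q_u(α)(1 - 2 α u)) + q(α) + 1.
-- The universal player therefore sets u to 1 exactly when q_u is negative at
-- the current partial assignment: q_u only mentions variables left of u, so
-- this is a legal strategy, and it makes every summand q_u(α)(1 - 2 α u)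
-- nonnegative.  Then the right-hand side is at least 1, so no play
-- consistent with this strategy satisfies φ.
module Submission where

open import Defs
open import Data.Nat using (ℕ)
open import Data.Sum using (_⊎_; inj₁; inj₂)

open import Algebra.Bundles using (CommutativeMonoid)
open import Data.Bool using (Bool; true; false; not; _∧_; _∨_; if_then_else_; T)
open import Data.Bool.Properties using (∧-commutativeMonoid; ∧-zeroʳ)
open import Data.Empty using (⊥-elim)
open import Data.Fin as F using (Fin; zero; suc)
open import Data.Fin.Properties using (_<?_)
open import Data.List as L using ([]; _∷_; _++_; allFin)
open import Data.List.Membership.Propositional using (_∈_)
open import Data.List.Membership.Propositional.Properties using (∈-allFin)
open import Data.List.Properties using (++-identityʳ)
open import Data.List.Relation.Unary.All using (_∷_)
open import Data.List.Relation.Unary.Any using (here; there)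
open import Data.Nat as N using (_≡ᵇ_; s≤s)
open import Data.Nat.Properties using (≤-refl; ≤-trans; m≤n⇒m≤1+n; ≮⇒≥)
open import Data.Product using (_×_; _,_)
open import Data.Rational as ℚ using (ℚ; 0ℚ; 1ℚ; _+_; _*_; -_; _-_; _≤_; _<_)
import Data.Rational.Properties as ℚP
open import Data.Rational.Solver using (module +-*-Solver)
open import Data.Vec using (Vec; []; _∷_; lookup; replicate; zipWith; tabulate)
import Data.Vec.Properties as VecP
open import Function using (_∘_)
open import Relation.Nullary using (Dec; yes; no; does)
open import Relation.Binary.PropositionalEquality

open import Algebra.Properties.Group ℚP.+-0-group using (x∙y⁻¹≈ε⇒x≈y)
open import Algebra.Properties.CommutativeSemigroup
  (CommutativeMonoid.commutativeSemigroup ∧-commutativeMonoid) using (interchange)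
open +-*-Solver using (solve; _:+_; _:*_; _:=_)

*-nonneg : ∀ {a b} → 0ℚ ≤ a → 0ℚ ≤ b → 0ℚ ≤ a * b
*-nonneg {a} {b} a≥0 b≥0 = ℚP.nonNegative⁻¹ (a * b)
  {{ℚP.nonNeg*nonNeg⇒nonNeg a {{ℚ.nonNegative a≥0}} b {{ℚ.nonNegative b≥0}}}}

ev : ∀ {n} → (Mono n → ℚ) → Poly n → ℚ
ev f [] = 0ℚ
ev f ((c , m) ∷ p) = c * f m + ev f p

dropMono : ∀ {n} → Mono n → Poly n → Poly n
dropMono m [] = []
dropMono m ((c , m') ∷ p) = if mono≟ m' m then dropMono m p else (c , m') ∷ dropMono m p

mono≟-sound : ∀ {n} (m m' : Mono n) → mono≟ m m' ≡ true → m ≡ m'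
mono≟-sound (mono a b) (mono c d) eq with VecP.≡-dec N._≟_ a c | VecP.≡-dec N._≟_ b d
mono≟-sound (mono a b) (mono c d) eq | yes refl | yes refl = refl
mono≟-sound (mono a b) (mono c d) () | yes _ | no _
mono≟-sound (mono a b) (mono c d) () | no _ | _

mono≟-refl : ∀ {n} (m : Mono n) → mono≟ m m ≡ true
mono≟-refl (mono a b) with VecP.≡-dec N._≟_ a a | VecP.≡-dec N._≟_ b b
... | yes _ | yes _ = refl
... | yes _ | no a≢a = ⊥-elim (a≢a refl)
... | no a≢a | _ = ⊥-elim (a≢a refl)

length-dropMono : ∀ {n} (m : Mono n) p → L.length (dropMono m p) N.≤ L.length p
length-dropMono m [] = N.z≤n
length-dropMono m ((c , m') ∷ p) with mono≟ m' m
... | true = m≤n⇒m≤1+n (length-dropMono m p)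
... | false = s≤s (length-dropMono m p)

length-dropMono-head : ∀ {n} (m : Mono n) c p → L.length (dropMono m ((c , m) ∷ p)) N.≤ L.length p
length-dropMono-head m c p rewrite mono≟-refl m = length-dropMono m p

coeff-dropMono : ∀ {n} (m m' : Mono n) p →
  coeff (dropMono m p) m' ≡ 0ℚ ⊎ coeff (dropMono m p) m' ≡ coeff p m'
coeff-dropMono m m' p with mono≟ m m' in eq
... | true rewrite mono≟-sound m m' eq = inj₁ (dropped m' p)
  where
  dropped : ∀ m p → coeff (dropMono m p) m ≡ 0ℚ
  dropped m [] = refl
  dropped m ((c , k) ∷ p) with mono≟ k m in eq
  ... | true = dropped m p
  ... | false rewrite eq = dropped m p
... | false = inj₂ (kept p)
  where
  kept : ∀ p → coeff (dropMono m p) m' ≡ coeff p m'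
  kept [] = refl
  kept ((c , k) ∷ p) with mono≟ k m in eq′
  ... | true rewrite mono≟-sound k m eq′ | eq = kept p
  ... | false with mono≟ k m'
  ...   | true = cong (c +_) (kept p)
  ...   | false = kept p

-- Removing the head monomial shortens the list, so this is well founded.
dropMono-induction : ∀ {n} (P : Poly n → Set) → P [] →
  (∀ c m p → P (dropMono m ((c , m) ∷ p)) → P ((c , m) ∷ p)) → ∀ p → P p
dropMono-induction P base step p = go (L.length p) p ≤-refl
  where
  go : ∀ k p → L.length p N.≤ k → P p
  go _ [] _ = base
  go (N.suc k) ((c , m) ∷ p) (s≤s l) = step c m p (go k _ (≤-trans (length-dropMono-head m c p) l))

module _ {n : ℕ} where

  ev-++ : ∀ (f : Mono n → ℚ) p q → ev f (p ++ q) ≡ ev f p + ev f q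
  ev-++ f [] q = sym (ℚP.+-identityˡ _)
  ev-++ f ((c , m) ∷ p) q rewrite ev-++ f p q = sym (ℚP.+-assoc (c * f m) (ev f p) (ev f q))

  ev-negP : ∀ (f : Mono n → ℚ) p → ev f (negP p) ≡ - ev f p
  ev-negP f [] = refl
  ev-negP f ((c , m) ∷ p) rewrite ev-negP f p =
    solve 3 (λ c x e → (:- c) :* x :+ (:- e) := :- (c :* x :+ e)) refl c (f m) (ev f p)
    where open +-*-Solver using (:-_)

  *P-cons : ∀ c m (p q : Poly n) → ((c , m) ∷ p) *P q ≡ (((c , m) ∷ []) *P q) ++ (p *P q)
  *P-cons c m p q = cong (_++ (p *P q)) (sym (++-identityʳ _))

  module _ (f : Mono n → ℚ) (f-·m : ∀ m m' → f (m ·m m') ≡ f m * f m') where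

    ev-*P-term : ∀ c m q → ev f (((c , m) ∷ []) *P q) ≡ c * f m * ev f q
    ev-*P-term c m [] = sym (ℚP.*-zeroʳ (c * f m))
    ev-*P-term c m ((d , m') ∷ q) rewrite f-·m m m' =
      trans (cong (c * d * (f m * f m') +_) (ev-*P-term c m q))
        (solve 5 (λ c d x y e → c :* d :* (x :* y) :+ c :* x :* e := c :* x :* (d :* y :+ e))
          refl c d (f m) (f m') (ev f q))

    ev-*P : ∀ p q → ev f (p *P q) ≡ ev f p * ev f q
    ev-*P [] q = sym (ℚP.*-zeroˡ (ev f q))
    ev-*P ((c , m) ∷ p) q = begin
      ev f (((c , m) ∷ p) *P q)                          ≡⟨ cong (ev f) (*P-cons c m p q) ⟩
      ev f ((((c , m) ∷ []) *P q) ++ (p *P q))            ≡⟨ ev-++ f (((c , m) ∷ []) *P q) (p *P q) ⟩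
      ev f (((c , m) ∷ []) *P q) + ev f (p *P q)          ≡⟨ cong₂ _+_ (ev-*P-term c m q) (ev-*P p q) ⟩
      c * f m * ev f q + ev f p * ev f q                  ≡⟨ sym (ℚP.*-distribʳ-+ (ev f q) (c * f m) (ev f p)) ⟩
      (c * f m + ev f p) * ev f q                         ∎
      where open ≡-Reasoning

  ev-dropMono : ∀ (f : Mono n → ℚ) m p → ev f p ≡ coeff p m * f m + ev f (dropMono m p)
  ev-dropMono f m [] = sym (trans (cong (_+ 0ℚ) (ℚP.*-zeroˡ (f m))) (ℚP.+-identityʳ 0ℚ))
  ev-dropMono f m ((c , m') ∷ p) with mono≟ m' m in eq
  ... | true rewrite mono≟-sound m' m eq | ev-dropMono f m p =
    solve 4 (λ c x k e → c :* x :+ (k :* x :+ e) := (c :+ k) :* x :+ e)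
      refl c (f m) (coeff p m) (ev f (dropMono m p))
  ... | false rewrite ev-dropMono f m p =
    solve 5 (λ c y k x e → c :* y :+ (k :* x :+ e) := k :* x :+ (c :* y :+ e))
      refl c (f m') (coeff p m) (f m) (ev f (dropMono m p))

  ev-cong-support : ∀ (f g : Mono n → ℚ) p → (∀ m → coeff p m ≢ 0ℚ → f m ≡ g m) → ev f p ≡ ev g p
  ev-cong-support f g = dropMono-induction _ (λ _ → refl) step
    where
    step : ∀ c m p → _ → _
    step c m p ih agree = begin
      ev f r                                   ≡⟨ ev-dropMono f m r ⟩
      coeff r m * f m + ev f (dropMono m r)    ≡⟨ cong₂ _+_ head (ih agree′) ⟩
      coeff r m * g m + ev g (dropMono m r)    ≡⟨ sym (ev-dropMono g m r) ⟩
      ev g r                                   ∎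
      where
      open ≡-Reasoning
      r = (c , m) ∷ p
      head : coeff r m * f m ≡ coeff r m * g m
      head with coeff r m ℚP.≟ 0ℚ
      ... | yes z rewrite z = trans (ℚP.*-zeroˡ (f m)) (sym (ℚP.*-zeroˡ (g m)))
      ... | no nz = cong (coeff r m *_) (agree m nz)
      agree′ : ∀ m′ → coeff (dropMono m r) m′ ≢ 0ℚ → f m′ ≡ g m′
      agree′ m′ nz with coeff-dropMono m m′ r
      ... | inj₁ z = ⊥-elim (nz z)
      ... | inj₂ e = agree m′ (nz ∘ trans e)

  ev-zero : ∀ (f : Mono n → ℚ) p → (∀ m → coeff p m ≡ 0ℚ) → ev f p ≡ 0ℚ
  ev-zero f = dropMono-induction _ (λ _ → refl) step
    where
    step : ∀ c m p → _ → _
    step c m p ih zero-coeffs = begin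
      ev f r                                   ≡⟨ ev-dropMono f m r ⟩
      coeff r m * f m + ev f (dropMono m r)    ≡⟨ cong₂ _+_ (cong (_* f m) (zero-coeffs m)) (ih zero-coeffs′) ⟩
      0ℚ * f m + 0ℚ                            ≡⟨ cong (_+ 0ℚ) (ℚP.*-zeroˡ (f m)) ⟩
      0ℚ                                       ∎
      where
      open ≡-Reasoning
      r = (c , m) ∷ p
      zero-coeffs′ : ∀ m′ → coeff (dropMono m r) m′ ≡ 0ℚ
      zero-coeffs′ m′ with coeff-dropMono m m′ r
      ... | inj₁ z = z
      ... | inj₂ e = trans e (zero-coeffs m′)

  ev-nonneg : ∀ (f : Mono n → ℚ) → (∀ m → 0ℚ ≤ f m) → ∀ p → (∀ m → 0ℚ ≤ coeff p m) → 0ℚ ≤ ev f p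
  ev-nonneg f f≥0 = dropMono-induction _ (λ _ → ℚP.≤-refl) step
    where
    step : ∀ c m p → _ → _
    step c m p ih coeffs≥0 = subst (0ℚ ≤_) (sym (ev-dropMono f m r))
      (ℚP.+-mono-≤ (*-nonneg (coeffs≥0 m) (f≥0 m)) (ih coeffs≥0′))
      where
      r = (c , m) ∷ p
      coeffs≥0′ : ∀ m′ → 0ℚ ≤ coeff (dropMono m r) m′
      coeffs≥0′ m′ with coeff-dropMono m m′ r
      ... | inj₁ z = ℚP.≤-reflexive (sym z)
      ... | inj₂ e = subst (0ℚ ≤_) (sym e) (coeffs≥0 m′)

  coeff-++ : ∀ (p q : Poly n) m → coeff (p ++ q) m ≡ coeff p m + coeff q m
  coeff-++ [] q m = sym (ℚP.+-identityˡ _)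
  coeff-++ ((c , k) ∷ p) q m with mono≟ k m
  ... | true rewrite coeff-++ p q m = sym (ℚP.+-assoc c (coeff p m) (coeff q m))
  ... | false = coeff-++ p q m

  coeff-negP : ∀ (p : Poly n) m → coeff (negP p) m ≡ - coeff p m
  coeff-negP [] m = refl
  coeff-negP ((c , k) ∷ p) m with mono≟ k m
  ... | true rewrite coeff-negP p m = sym (ℚP.neg-distrib-+ c (coeff p m))
  ... | false = coeff-negP p m

  ev-resp-≈P : ∀ (f : Mono n → ℚ) p p′ → p ≈P p′ → ev f p ≡ ev f p′
  ev-resp-≈P f p p′ p≈p′ = x∙y⁻¹≈ε⇒x≈y (ev f p) (ev f p′) (begin
    ev f p - ev f p′           ≡⟨ cong (ev f p +_) (ev-negP f p′) ⟨
    ev f p + ev f (negP p′)    ≡⟨ ev-++ f p (negP p′) ⟨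
    ev f (p -P p′)             ≡⟨ ev-zero f (p -P p′) coeff-difference ⟩
    0ℚ                         ∎)
    where
    open ≡-Reasoning
    coeff-difference : ∀ m → coeff (p -P p′) m ≡ 0ℚ
    coeff-difference m = begin
      coeff (p -P p′) m          ≡⟨ coeff-++ p (negP p′) m ⟩
      coeff p m + coeff (negP p′) m ≡⟨ cong₂ (λ a b → a + b) (p≈p′ m) (coeff-negP p′ m) ⟩
      coeff p′ m - coeff p′ m    ≡⟨ ℚP.+-inverseʳ (coeff p′ m) ⟩
      0ℚ                         ∎

-- Boolean points: a monomial ∏ v^(a v) v̄^(b v) takes the value 1 at α if
-- α v = 1 whenever a v > 0 and α v = 0 whenever b v > 0, and 0 otherwise.

litHolds : Bool → ℕ → ℕ → Bool
litHolds true  a b = b ≡ᵇ 0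
litHolds false a b = a ≡ᵇ 0

monoHolds : ∀ {n} → Assignment n → Vec ℕ n → Vec ℕ n → Bool
monoHolds α [] [] = true
monoHolds α (a ∷ as) (b ∷ bs) = litHolds (α zero) a b ∧ monoHolds (α ∘ suc) as bs

b2q : Bool → ℚ
b2q true = 1ℚ
b2q false = 0ℚ

b2q-∧ : ∀ x y → b2q (x ∧ y) ≡ b2q x * b2q y
b2q-∧ true true = refl
b2q-∧ true false = refl
b2q-∧ false y = sym (ℚP.*-zeroˡ (b2q y))

evalMono : ∀ {n} → Assignment n → Mono n → ℚ
evalMono α m = b2q (monoHolds α (vexp m) (bexp m))

eval : ∀ {n} → Assignment n → Poly n → ℚ
eval α = ev (evalMono α)

≡ᵇ0-+ : ∀ a c → (a N.+ c ≡ᵇ 0) ≡ ((a ≡ᵇ 0) ∧ (c ≡ᵇ 0))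
≡ᵇ0-+ N.zero c = refl
≡ᵇ0-+ (N.suc a) c = refl

litHolds-+ : ∀ x a b c d → litHolds x (a N.+ c) (b N.+ d) ≡ (litHolds x a b ∧ litHolds x c d)
litHolds-+ true a b c d = ≡ᵇ0-+ b d
litHolds-+ false a b c d = ≡ᵇ0-+ a c

monoHolds-·m : ∀ {n} (α : Assignment n) a b c d →
  monoHolds α (zipWith N._+_ a c) (zipWith N._+_ b d) ≡ (monoHolds α a b ∧ monoHolds α c d)
monoHolds-·m α [] [] [] [] = refl
monoHolds-·m α (a ∷ as) (b ∷ bs) (c ∷ cs) (d ∷ ds)
  rewrite litHolds-+ (α zero) a b c d | monoHolds-·m (α ∘ suc) as bs cs ds =
  interchange (litHolds (α zero) a b) (litHolds (α zero) c d)
              (monoHolds (α ∘ suc) as bs) (monoHolds (α ∘ suc) cs ds)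

litHolds-0 : ∀ x → litHolds x 0 0 ≡ true
litHolds-0 true = refl
litHolds-0 false = refl

monoHolds-agree : ∀ {n} (α β : Assignment n) a b →
  (∀ v → (lookup a v ≡ 0 × lookup b v ≡ 0) ⊎ α v ≡ β v) → monoHolds α a b ≡ monoHolds β a b
monoHolds-agree α β [] [] agree = refl
monoHolds-agree α β (a ∷ as) (b ∷ bs) agree
  rewrite monoHolds-agree (α ∘ suc) (β ∘ suc) as bs (agree ∘ suc) with agree zero
... | inj₁ (refl , refl) rewrite litHolds-0 (α zero) | litHolds-0 (β zero) = refl
... | inj₂ e rewrite e = refl

monoHolds-unit : ∀ {n} (α : Assignment n) → monoHolds α (replicate n 0) (replicate n 0) ≡ true
monoHolds-unit {N.zero} α = refl
monoHolds-unit {N.suc n} α rewrite litHolds-0 (α zero) = monoHolds-unit (α ∘ suc)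

tabulate-const : ∀ {n} (x : ℕ) → tabulate {n = n} (λ _ → x) ≡ replicate n x
tabulate-const {N.zero} x = refl
tabulate-const {N.suc n} x = cong (x ∷_) (tabulate-const x)

indicator : ∀ {n} → Fin n → Vec ℕ n
indicator v = tabulate (λ w → if F.toℕ w ≡ᵇ F.toℕ v then 1 else 0)

litHolds-var : ∀ x → litHolds x 1 0 ∧ true ≡ x
litHolds-var true = refl
litHolds-var false = refl

litHolds-bar : ∀ x → litHolds x 0 1 ∧ true ≡ not x
litHolds-bar true = refl
litHolds-bar false = refl

monoHolds-var : ∀ {n} (α : Assignment n) v → monoHolds α (indicator v) (replicate n 0) ≡ α v
monoHolds-var {N.suc n} α zero
  rewrite tabulate-const {n} 0 | monoHolds-unit (α ∘ suc) = litHolds-var (α zero)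
monoHolds-var {N.suc n} α (suc v) rewrite litHolds-0 (α zero) = monoHolds-var (α ∘ suc) v

monoHolds-bar : ∀ {n} (α : Assignment n) v → monoHolds α (replicate n 0) (indicator v) ≡ not (α v)
monoHolds-bar {N.suc n} α zero
  rewrite tabulate-const {n} 0 | monoHolds-unit (α ∘ suc) = litHolds-bar (α zero)
monoHolds-bar {N.suc n} α (suc v) rewrite litHolds-0 (α zero) = monoHolds-bar (α ∘ suc) v

module _ {n : ℕ} (α : Assignment n) where

  evalMono-·m : ∀ m m′ → evalMono α (m ·m m′) ≡ evalMono α m * evalMono α m′
  evalMono-·m (mono a b) (mono c d) rewrite monoHolds-·m α a b c d = b2q-∧ (monoHolds α a b) (monoHolds α c d)

  eval-++ : ∀ p q → eval α (p ++ q) ≡ eval α p + eval α q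
  eval-++ = ev-++ (evalMono α)

  eval-*P : ∀ p q → eval α (p *P q) ≡ eval α p * eval α q
  eval-*P = ev-*P (evalMono α) evalMono-·m

  eval-negP : ∀ p → eval α (negP p) ≡ - eval α p
  eval-negP = ev-negP (evalMono α)

  eval-constP : ∀ c → eval α (constP c) ≡ c
  eval-constP c rewrite monoHolds-unit α = trans (ℚP.+-identityʳ (c * 1ℚ)) (ℚP.*-identityʳ c)

  eval-varP : ∀ v → eval α (varP v) ≡ b2q (α v)
  eval-varP v rewrite monoHolds-var α v = trans (ℚP.+-identityʳ _) (ℚP.*-identityˡ _)

  eval-barP : ∀ v → eval α (barP v) ≡ b2q (not (α v))
  eval-barP v rewrite monoHolds-bar α v = trans (ℚP.+-identityʳ _) (ℚP.*-identityˡ _)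

  eval-booleanAx : ∀ v → eval α (booleanAx v) ≡ 0ℚ
  eval-booleanAx v = begin
    eval α (booleanAx v)                              ≡⟨ eval-++ (varP v *P varP v) (negP (varP v)) ⟩
    eval α (varP v *P varP v) + eval α (negP (varP v)) ≡⟨ cong₂ _+_ (eval-*P (varP v) (varP v)) (eval-negP (varP v)) ⟩
    eval α (varP v) * eval α (varP v) - eval α (varP v) ≡⟨ cong (λ x → x * x - x) (eval-varP v) ⟩
    b2q (α v) * b2q (α v) - b2q (α v)                 ≡⟨ b2q-idempotent (α v) ⟩
    0ℚ                                                ∎
    where
    open ≡-Reasoning
    b2q-idempotent : ∀ x → b2q x * b2q x - b2q x ≡ 0ℚ
    b2q-idempotent true = refl
    b2q-idempotent false = refl

  eval-twinAx : ∀ v → eval α (twinAx v) ≡ 0ℚ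
  eval-twinAx v = begin
    eval α (twinAx v)                                   ≡⟨ eval-++ (varP v +P barP v) (negP 1P) ⟩
    eval α (varP v +P barP v) + eval α (negP 1P)         ≡⟨ cong₂ _+_ (eval-++ (varP v) (barP v)) (eval-negP 1P) ⟩
    eval α (varP v) + eval α (barP v) - eval α 1P        ≡⟨ cong₂ (λ x y → x + y - eval α 1P) (eval-varP v) (eval-barP v) ⟩
    b2q (α v) + b2q (not (α v)) - eval α 1P             ≡⟨ cong (λ y → b2q (α v) + b2q (not (α v)) - y) (eval-constP 1ℚ) ⟩
    b2q (α v) + b2q (not (α v)) - 1ℚ                    ≡⟨ b2q-complement (α v) ⟩
    0ℚ                                                  ∎
    where
    open ≡-Reasoning
    b2q-complement : ∀ x → b2q x + b2q (not x) - 1ℚ ≡ 0ℚ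
    b2q-complement true = refl
    b2q-complement false = refl

  eval-*P-zeroʳ : ∀ p {q} → eval α q ≡ 0ℚ → eval α (p *P q) ≡ 0ℚ
  eval-*P-zeroʳ p {q} q≡0 = trans (eval-*P p q) (trans (cong (eval α p *_) q≡0) (ℚP.*-zeroʳ (eval α p)))

  eval-sumP-zero : ∀ {A : Set} (G : A → Poly n) → (∀ x → eval α (G x) ≡ 0ℚ) →
    ∀ xs → eval α (sumP (L.map G xs)) ≡ 0ℚ
  eval-sumP-zero G G≡0 [] = refl
  eval-sumP-zero G G≡0 (x ∷ xs) = trans (eval-++ (G x) (sumP (L.map G xs)))
    (cong₂ _+_ (G≡0 x) (eval-sumP-zero G G≡0 xs))

  eval-sumP-nonneg : ∀ {A : Set} (G : A → Poly n) → (∀ x → 0ℚ ≤ eval α (G x)) →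
    ∀ xs → 0ℚ ≤ eval α (sumP (L.map G xs))
  eval-sumP-nonneg G G≥0 [] = ℚP.≤-refl
  eval-sumP-nonneg G G≥0 (x ∷ xs) = subst (0ℚ ≤_) (sym (eval-++ (G x) (sumP (L.map G xs))))
    (ℚP.+-mono-≤ (G≥0 x) (eval-sumP-nonneg G G≥0 xs))

  eval-prodP-zero : ∀ {A : Set} (G : A → Poly n) {x} → eval α (G x) ≡ 0ℚ →
    ∀ {xs} → x ∈ xs → eval α (prodP (L.map G xs)) ≡ 0ℚ
  eval-prodP-zero G Gx≡0 {y ∷ ys} (here refl) =
    trans (eval-*P (G y) (prodP (L.map G ys)))
      (trans (cong (_* eval α (prodP (L.map G ys))) Gx≡0) (ℚP.*-zeroˡ (eval α (prodP (L.map G ys)))))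
  eval-prodP-zero G Gx≡0 {y ∷ ys} (there x∈ys) = eval-*P-zeroʳ (G y) (eval-prodP-zero G Gx≡0 x∈ys)

  eval-ΣV[]-zero : ∀ b (f : Fin n → Poly n) → (∀ v → eval α (f v) ≡ 0ℚ) → eval α (ΣV[ b ] f) ≡ 0ℚ
  eval-ΣV[]-zero b f f≡0 = eval-sumP-zero _ term≡0 (allFin n)
    where
    term≡0 : ∀ v → eval α (if b v then f v else 0P) ≡ 0ℚ
    term≡0 v with b v
    ... | true = f≡0 v
    ... | false = refl

  eval-ΣV[]-nonneg : ∀ b (f : Fin n → Poly n) → (∀ v → b v ≡ true → 0ℚ ≤ eval α (f v)) →
    0ℚ ≤ eval α (ΣV[ b ] f)
  eval-ΣV[]-nonneg b f f≥0 = eval-sumP-nonneg _ term≥0 (allFin n)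
    where
    term≥0 : ∀ v → 0ℚ ≤ eval α (if b v then f v else 0P)
    term≥0 v with b v in bv
    ... | true = f≥0 v bv
    ... | false = ℚP.≤-refl

  eval-ifBarP : ∀ v p → eval α (if p then barP v else 1P) ≡ b2q (not p ∨ not (α v))
  eval-ifBarP v true = eval-barP v
  eval-ifBarP v false = eval-constP 1ℚ

  eval-ifVarP : ∀ v p → eval α (if p then varP v else 1P) ≡ b2q (not p ∨ α v)
  eval-ifVarP v true = eval-varP v
  eval-ifVarP v false = eval-constP 1ℚ

  eval-clauseMonoP : ∀ C → SatClause α C → eval α (clauseMonoP C) ≡ 0ℚ
  eval-clauseMonoP C (v , sat) = eval-prodP-zero _ factor≡0 (∈-allFin v)
    where
    p = lookup (P C) v
    nn = lookup (N C) v
    falsified : ∀ p nn x → T ((p ∧ x) ∨ (nn ∧ not x)) → ((not p ∨ not x) ∧ (not nn ∨ x)) ≡ false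
    falsified true  nn    true  _ = refl
    falsified p     true  false _ = ∧-zeroʳ (not p ∨ true)
    falsified true  false false ()
    falsified false true  true  ()
    falsified false false true  ()
    falsified false false false ()
    factor≡0 : eval α ((if p then barP v else 1P) *P (if nn then varP v else 1P)) ≡ 0ℚ
    factor≡0 = begin
      eval α ((if p then barP v else 1P) *P (if nn then varP v else 1P))
        ≡⟨ eval-*P (if p then barP v else 1P) (if nn then varP v else 1P) ⟩
      eval α (if p then barP v else 1P) * eval α (if nn then varP v else 1P)
        ≡⟨ cong₂ _*_ (eval-ifBarP v p) (eval-ifVarP v nn) ⟩
      b2q (not p ∨ not (α v)) * b2q (not nn ∨ α v)
        ≡⟨ b2q-∧ (not p ∨ not (α v)) (not nn ∨ α v) ⟨
      b2q ((not p ∨ not (α v)) ∧ (not nn ∨ α v))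
        ≡⟨ cong b2q (falsified p nn (α v) sat) ⟩
      0ℚ ∎
      where open ≡-Reasoning

  eval-encSum : ∀ C k → SatClause α C → eval α (encSum C k) ≡ 0ℚ
  eval-encSum C k sat = trans (eval-++ (qMain k *P clauseMonoP C) _)
    (cong₂ _+_ (eval-*P-zeroʳ (qMain k) (eval-clauseMonoP C sat))
               (eval-ΣV[]-zero (inVars C) _ axioms≡0))
    where
    axioms≡0 : ∀ v → eval α ((qBool k v *P booleanAx v) +P (qTwin k v *P twinAx v)) ≡ 0ℚ
    axioms≡0 v = trans (eval-++ (qBool k v *P booleanAx v) (qTwin k v *P twinAx v))
      (cong₂ _+_ (eval-*P-zeroʳ (qBool k v) (eval-booleanAx v)) (eval-*P-zeroʳ (qTwin k v) (eval-twinAx v)))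

  eval-encSumCNF : ∀ φ ks → Sat α φ → eval α (encSumCNF φ ks) ≡ 0ℚ
  eval-encSumCNF [] ks _ = refl
  eval-encSumCNF (C ∷ φ) ks (sat ∷ sats) = trans (eval-++ (encSum C (ks zero)) _)
    (cong₂ _+_ (eval-encSum C (ks zero) sat) (eval-encSumCNF φ (ks ∘ suc) sats))

eval-cong : ∀ {n} {α β : Assignment n} → (∀ v → α v ≡ β v) → ∀ p → eval α p ≡ eval β p
eval-cong {α = α} {β} α≗β p = ev-cong-support _ _ p
  (λ m _ → cong b2q (monoHolds-agree α β (vexp m) (bexp m) (inj₂ ∘ α≗β)))

pastOf : ∀ {n} → Fin n → Assignment n → Assignment n
pastOf u α v with v <? u
... | yes _ = α v
... | no _ = false

pastOf-cong : ∀ {n} u (α β : Assignment n) → (∀ v → v F.< u → α v ≡ β v) →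
  ∀ v → pastOf u α v ≡ pastOf u β v
pastOf-cong u α β agree v with v <? u
... | yes v<u = agree v v<u
... | no _ = refl

eval-pastOf : ∀ {n} u (α : Assignment n) p → OnlyLeftOf u p → eval α p ≡ eval (pastOf u α) p
eval-pastOf u α p onlyLeft = ev-cong-support _ _ p
  (λ m nz → cong b2q (monoHolds-agree α (pastOf u α) (vexp m) (bexp m) (agree m nz)))
  where
  agree : ∀ m → coeff p m ≢ 0ℚ → ∀ v → (lookup (vexp m) v ≡ 0 × lookup (bexp m) v ≡ 0) ⊎ α v ≡ pastOf u α v
  agree m nz v with v <? u
  ... | yes _ = inj₂ refl
  ... | no v≮u = inj₁ (onlyLeft m nz v (≮⇒≥ v≮u))

signStrategy : ∀ {n} → (Fin n → Poly n) → UStrategy n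
choose (signStrategy qU) u α = does (eval (pastOf u α) (qU u) ℚP.<? 0ℚ)
onlyPast (signStrategy qU) u α β agree =
  cong (λ x → does (x ℚP.<? 0ℚ)) (eval-cong (pastOf-cong u α β agree) (qU u))

signFlip : Bool → ℚ
signFlip b = 1ℚ - (1ℚ + 1ℚ) * b2q b

*-signFlip-nonneg : ∀ x (x<?0 : Dec (x < 0ℚ)) → 0ℚ ≤ x * signFlip (does x<?0)
*-signFlip-nonneg x (yes x<0) = subst (0ℚ ≤_) (trans (cong -_ (sym (ℚP.*-identityʳ x))) (ℚP.neg-distribʳ-* x 1ℚ))
  (ℚP.<⇒≤ (ℚP.neg-antimono-< x<0))
*-signFlip-nonneg x (no x≮0) = subst (0ℚ ≤_) (sym (ℚP.*-identityʳ x)) (ℚP.≮⇒≥ x≮0)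

universalFactor : ∀ {n} → Fin n → Poly n
universalFactor u = 1P -P (constP (1ℚ + 1ℚ) *P varP u)

eval-universalFactor : ∀ {n} (α : Assignment n) u → eval α (universalFactor u) ≡ signFlip (α u)
eval-universalFactor α u = begin
  eval α (1P -P (constP (1ℚ + 1ℚ) *P varP u))
    ≡⟨ eval-++ α 1P (negP (constP (1ℚ + 1ℚ) *P varP u)) ⟩
  eval α 1P + eval α (negP (constP (1ℚ + 1ℚ) *P varP u))
    ≡⟨ cong₂ _+_ (eval-constP α 1ℚ) (eval-negP α (constP (1ℚ + 1ℚ) *P varP u)) ⟩
  1ℚ - eval α (constP (1ℚ + 1ℚ) *P varP u)
    ≡⟨ cong (λ x → 1ℚ - x) (eval-*P α (constP (1ℚ + 1ℚ)) (varP u)) ⟩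
  1ℚ - eval α (constP (1ℚ + 1ℚ)) * eval α (varP u)
    ≡⟨ cong₂ (λ x y → 1ℚ - x * y) (eval-constP α (1ℚ + 1ℚ)) (eval-varP α u) ⟩
  signFlip (α u) ∎
  where open ≡-Reasoning

module _ {n} {Q : Prefix n} {φ : CNF n} {Good : Poly n → Set}
         (good-nonneg : ∀ q → Good q → ∀ α → 0ℚ ≤ eval α q) (R : Refutation Q φ Good) where
  open Refutation R

  universalTerm-nonneg : ∀ α → Consistent Q (signStrategy qU) α → ∀ u → Q u ≡ univ →
    0ℚ ≤ eval α (qU u *P universalFactor u)
  universalTerm-nonneg α consistent u univ-u =
    subst (0ℚ ≤_) (sym value) (*-signFlip-nonneg (eval α (qU u)) (eval α (qU u) ℚP.<? 0ℚ))
    where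
    open ≡-Reasoning
    value : eval α (qU u *P universalFactor u) ≡ eval α (qU u) * signFlip (does (eval α (qU u) ℚP.<? 0ℚ))
    value = begin
      eval α (qU u *P universalFactor u)
        ≡⟨ eval-*P α (qU u) (universalFactor u) ⟩
      eval α (qU u) * eval α (universalFactor u)
        ≡⟨ cong (eval α (qU u) *_) (eval-universalFactor α u) ⟩
      eval α (qU u) * signFlip (α u)
        ≡⟨ cong (λ b → eval α (qU u) * signFlip b) (consistent u univ-u) ⟩
      eval α (qU u) * signFlip (does (eval (pastOf u α) (qU u) ℚP.<? 0ℚ))
        ≡⟨ cong (λ x → eval α (qU u) * signFlip (does (x ℚP.<? 0ℚ))) (eval-pastOf u α (qU u) (qU-ok u univ-u)) ⟨
      eval α (qU u) * signFlip (does (eval α (qU u) ℚP.<? 0ℚ)) ∎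

  signStrategy-wins : UWins Q φ (signStrategy qU)
  signStrategy-wins α consistent sat = ℚP.<-irrefl (sym lhs≡0) 0<lhs
    where
    U = ΣV[ (λ u → isForall (Q u)) ] (λ u → qU u *P universalFactor u)
    lhs = encSumCNF φ qEnc +P U +P q +P 1P
    lhs≡0 : eval α lhs ≡ 0ℚ
    lhs≡0 = ev-resp-≈P (evalMono α) lhs 0P identity
    U≥0 : 0ℚ ≤ eval α U
    U≥0 = eval-ΣV[]-nonneg α _ _
      (λ u forall-u → universalTerm-nonneg α consistent u (isForall⇒univ (Q u) forall-u))
      where
      isForall⇒univ : ∀ x → isForall x ≡ true → x ≡ univ
      isForall⇒univ univ _ = refl
    lhs-value : eval α lhs ≡ eval α (encSumCNF φ qEnc) + eval α U + eval α q + 1ℚ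
    lhs-value rewrite eval-++ α (encSumCNF φ qEnc +P U +P q) 1P | eval-++ α (encSumCNF φ qEnc +P U) q
                    | eval-++ α (encSumCNF φ qEnc) U | eval-constP α 1ℚ = refl
    0<lhs : 0ℚ < eval α lhs
    0<lhs = subst (0ℚ <_) (sym lhs-value) (ℚP.+-mono-≤-< sum≥0 (ℚP.positive⁻¹ 1ℚ))
      where
      sum≥0 : 0ℚ ≤ eval α (encSumCNF φ qEnc) + eval α U + eval α q
      sum≥0 rewrite eval-encSumCNF α φ qEnc sat | ℚP.+-identityˡ (eval α U) =
        ℚP.+-mono-≤ U≥0 (good-nonneg q q-good α)

  refutation⇒QBFFalse : QBFFalse Q φ
  refutation⇒QBFFalse = signStrategy qU , signStrategy-wins

square-nonneg : ∀ x → 0ℚ ≤ x * x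
square-nonneg x with ℚP.≤-total 0ℚ x
... | inj₁ x≥0 = *-nonneg x≥0 x≥0
... | inj₂ x≤0 = subst (_≤ x * x) (ℚP.*-zeroʳ x) (ℚP.*-monoˡ-≤-nonPos x {{ℚ.nonPositive x≤0}} x≤0)

module _ {n : ℕ} (q : Poly n) where

  isZeroP⇒eval-nonneg : IsZeroP q → ∀ α → 0ℚ ≤ eval α q
  isZeroP⇒eval-nonneg q≈0 α = ℚP.≤-reflexive (sym (ev-zero (evalMono α) q q≈0))

  nonnegCoeffs⇒eval-nonneg : NonnegCoeffs q → ∀ α → 0ℚ ≤ eval α q
  nonnegCoeffs⇒eval-nonneg q≥0 α = ev-nonneg (evalMono α) (λ m → b2q-nonneg (monoHolds α (vexp m) (bexp m))) q q≥0
    where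
    b2q-nonneg : ∀ x → 0ℚ ≤ b2q x
    b2q-nonneg true = ℚP.nonNegative⁻¹ 1ℚ
    b2q-nonneg false = ℚP.≤-refl

  isSoS⇒eval-nonneg : IsSoS q → ∀ α → 0ℚ ≤ eval α q
  isSoS⇒eval-nonneg (ss , q≈sos) α =
    subst (0ℚ ≤_) (sym (ev-resp-≈P (evalMono α) q (sumP (L.map (λ s → s *P s) ss)) q≈sos))
      (eval-sumP-nonneg α (λ s → s *P s) square≥0 ss)
    where
    square≥0 : ∀ s → 0ℚ ≤ eval α (s *P s)
    square≥0 s = subst (0ℚ ≤_) (sym (eval-*P α s s)) (square-nonneg (eval α s))

theorem3p2 : (n : ℕ) (Q : Prefix n) (φ : CNF n) →
    QNSRefutation Q φ ⊎ QSARefutation Q φ ⊎ QSoSRefutation Q φ →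
    QBFFalse Q φ
theorem3p2 n Q φ (inj₁ R) = refutation⇒QBFFalse isZeroP⇒eval-nonneg R
theorem3p2 n Q φ (inj₂ (inj₁ R)) = refutation⇒QBFFalse nonnegCoeffs⇒eval-nonneg R
theorem3p2 n Q φ (inj₂ (inj₂ R)) = refutation⇒QBFFalse isSoS⇒eval-nonneg R
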